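{- Let $A$ and $B$ be two finite conjunctions of linear arithmetic atoms over the rationals (equalities, weak and strict inequalities and disequalities between linear terms), and let $n = (0\ne t)$ be one of these atoms. Let $g=(0<t)$ and $l=(0>t)$. If $n\in A$, let $A^+ = (A\setminus\{n\})\cup\{g\}$, $A^-=(A\setminus\{n\})\cup\{l\}$ and $B^+=B^-=B$. If $n\in B$, let $A^+=A^-=A$, $B^+=(B\setminus\{n\})\cup\{g\}$ and $B^- = (B\setminus\{n\})\cup\{l\}$. Assume that $A^+\wedge B^+$ and $A^-\wedge B^-$ are both unsatisfiable over $\mathbb Q$, and let $I^+$ and $I^-$ be interpolants for $(A^+,B^+)$ and $(A^-,B^-)$ respectively. Let $I = I^+\vee I^-$ if $n\in A$, and $I = I^+\wedge I^-$ if $n\in B$. Then $I$ is an interpolant for $(A,B)$.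
   Context: An interpolant for a pair $(X,Y)$ of formulas with $X\wedge Y$ unsatisfiable over $\mathbb Q$ is a formula $I$ such that $X\models I$, $I\wedge Y$ is unsatisfiable, and every variable occurring in $I$ occurs both in $X$ and in $Y$. -}

module Defs where

open import Data.Nat using (ℕ)
import Data.Nat as ℕ
open import Data.Rational using (ℚ; 0ℚ; _+_; _*_; _<_; _≤_)
import Data.Rational.Properties as ℚP
open import Data.Product using (_×_; _,_; proj₁; proj₂)
import Data.Product.Properties as ×P
open import Data.List using (List; []; _∷_; foldr; map; filter; _++_)
import Data.List.Properties as LP
open import Data.List.Membership.Propositional using (_∈_)
open import Data.Sum using (_⊎_)
open import Data.Unit using (⊤)
open import Data.Empty using (⊥)
open import Relation.Nullary using (¬_; ¬?; yes; no)
open import Relation.Binary.PropositionalEquality using (_≡_; refl; cong)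
open import Relation.Binary.Definitions using (DecidableEquality)

Var : Set
Var = ℕ

Assignment : Set
Assignment = Var → ℚ

-- A linear term  c + Σ aᵢ·xᵢ  represented as (c , [(a₁,x₁), …]).
LinTerm : Set
LinTerm = ℚ × List (ℚ × Var)

zeroT : LinTerm
zeroT = (0ℚ , [])

evalT : Assignment → LinTerm → ℚ
evalT σ (c , ms) = foldr (λ m acc → proj₁ m * σ (proj₂ m) + acc) c ms

OccursT : Var → LinTerm → Set
OccursT x (c , ms) = x ∈ map proj₂ ms

data RelOp : Set where
  eqR leR ltR neR : RelOp

data Atom : Set where
  mkAtom : RelOp → LinTerm → LinTerm → Atom

holdsA : Assignment → Atom → Set
holdsA σ (mkAtom eqR s t) = evalT σ s ≡ evalT σ t
holdsA σ (mkAtom leR s t) = evalT σ s ≤ evalT σ t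
holdsA σ (mkAtom ltR s t) = evalT σ s < evalT σ t
holdsA σ (mkAtom neR s t) = ¬ (evalT σ s ≡ evalT σ t)

OccursA : Var → Atom → Set
OccursA x (mkAtom _ s t) = OccursT x s ⊎ OccursT x t

data Formula : Set where
  atom       : Atom → Formula
  true false : Formula
  _∧ᶠ_ _∨ᶠ_  : Formula → Formula → Formula
  ¬ᶠ_        : Formula → Formula

_⊨_ : Assignment → Formula → Set
σ ⊨ atom a   = holdsA σ a
σ ⊨ true     = ⊤
σ ⊨ false    = ⊥
σ ⊨ (φ ∧ᶠ ψ) = (σ ⊨ φ) × (σ ⊨ ψ)
σ ⊨ (φ ∨ᶠ ψ) = (σ ⊨ φ) ⊎ (σ ⊨ ψ)
σ ⊨ (¬ᶠ φ)   = ¬ (σ ⊨ φ)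

Occurs : Var → Formula → Set
Occurs x (atom a)   = OccursA x a
Occurs x true       = ⊥
Occurs x false      = ⊥
Occurs x (φ ∧ᶠ ψ)   = Occurs x φ ⊎ Occurs x ψ
Occurs x (φ ∨ᶠ ψ)   = Occurs x φ ⊎ Occurs x ψ
Occurs x (¬ᶠ φ)     = Occurs x φ

Conj : List Atom → Formula
Conj []       = true
Conj (a ∷ as) = atom a ∧ᶠ Conj as

Unsat : Formula → Set
Unsat φ = (σ : Assignment) → ¬ (σ ⊨ φ)

_⊨ᶠ_ : Formula → Formula → Set
φ ⊨ᶠ ψ = (σ : Assignment) → σ ⊨ φ → σ ⊨ ψ

record Interpolant (X Y I : Formula) : Set where
  field
    entails : X ⊨ᶠ I
    unsatY  : Unsat (I ∧ᶠ Y)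
    shared  : (x : Var) → Occurs x I → Occurs x X × Occurs x Y

_≟R_ : DecidableEquality RelOp
eqR ≟R eqR = yes refl
eqR ≟R leR = no λ ()
eqR ≟R ltR = no λ ()
eqR ≟R neR = no λ ()
leR ≟R eqR = no λ ()
leR ≟R leR = yes refl
leR ≟R ltR = no λ ()
leR ≟R neR = no λ ()
ltR ≟R eqR = no λ ()
ltR ≟R leR = no λ ()
ltR ≟R ltR = yes refl
ltR ≟R neR = no λ ()
neR ≟R eqR = no λ ()
neR ≟R leR = no λ ()
neR ≟R ltR = no λ ()
neR ≟R neR = yes refl

_≟T_ : DecidableEquality LinTerm
_≟T_ = ×P.≡-dec ℚP._≟_ (LP.≡-dec (×P.≡-dec ℚP._≟_ ℕ._≟_))

_≟A_ : DecidableEquality Atom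
mkAtom r s t ≟A mkAtom r' s' t' with r ≟R r' | s ≟T s' | t ≟T t'
... | yes refl | yes refl | yes refl = yes refl
... | no p | _ | _ = no λ { refl → p refl }
... | yes _ | no p | _ = no λ { refl → p refl }
... | yes _ | yes _ | no p = no λ { refl → p refl }

replace : Atom → Atom → List Atom → List Atom
replace n a A = filter (λ b → ¬? (b ≟A n)) A ++ (a ∷ [])

nAtom gAtom lAtom : LinTerm → Atom
nAtom t = mkAtom neR zeroT t
gAtom t = mkAtom ltR zeroT t
lAtom t = mkAtom ltR t zeroT

-- An assignment satisfying 0 ≠ t satisfies 0 < t or t < 0, and these two atoms mention no
-- variable outside t. So splitting the disequality n into the cases g and l is sound, and
-- interpolants of the two cases combine: by ∨ when n belongs to the A side (A entails one of
-- A⁺, A⁻), by ∧ when n belongs to the B side (B is refuted by refuting both B⁺ and B⁻).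
module Submission where

open import Defs
open import Data.List using (List; []; _∷_; filter; _++_)
open import Data.List.Membership.Propositional using (_∈_)
open import Data.List.Relation.Unary.Any using (here; there)
open import Data.Product using (_×_; _,_)
open import Data.Sum using (_⊎_; inj₁; inj₂)
open import Data.Empty using (⊥-elim)
open import Data.Rational using (0ℚ)
open import Data.Rational.Properties using (<-cmp)
open import Relation.Nullary using (¬?; yes; no)
open import Relation.Binary.PropositionalEquality using (refl)
open import Relation.Binary.Definitions using (tri<; tri≈; tri>)

private
  variable
    σ : Assignment
    x : Var
    n a : Atom
    xs ys : List Atom

Conj-++⁺ : ∀ xs → σ ⊨ Conj xs → σ ⊨ Conj ys → σ ⊨ Conj (xs ++ ys)
Conj-++⁺ []       _         h = h
Conj-++⁺ (_ ∷ xs) (hx , hs) h = hx , Conj-++⁺ xs hs h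

Conj-filter⁺ : ∀ n xs → σ ⊨ Conj xs → σ ⊨ Conj (filter (λ b → ¬? (b ≟A n)) xs)
Conj-filter⁺ n []       _         = _
Conj-filter⁺ n (y ∷ xs) (hy , hs) with y ≟A n
... | yes _ = Conj-filter⁺ n xs hs
... | no  _ = hy , Conj-filter⁺ n xs hs

Conj-replace⁺ : ∀ n xs → σ ⊨ Conj xs → holdsA σ a → σ ⊨ Conj (replace n a xs)
Conj-replace⁺ n xs hs ha = Conj-++⁺ (filter (λ b → ¬? (b ≟A n)) xs) (Conj-filter⁺ n xs hs) (ha , _)

Conj-∈ : a ∈ xs → σ ⊨ Conj xs → holdsA σ a
Conj-∈ (here refl) (ha , _) = ha
Conj-∈ (there a∈)  (_ , hs) = Conj-∈ a∈ hs

Occurs-Conj-∈ : a ∈ xs → OccursA x a → Occurs x (Conj xs)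
Occurs-Conj-∈ (here refl) o = inj₁ o
Occurs-Conj-∈ (there a∈)  o = inj₂ (Occurs-Conj-∈ a∈ o)

Occurs-Conj-++⁻ : ∀ xs → Occurs x (Conj (xs ++ ys)) → Occurs x (Conj xs) ⊎ Occurs x (Conj ys)
Occurs-Conj-++⁻ []       o        = inj₂ o
Occurs-Conj-++⁻ (_ ∷ _)  (inj₁ o) = inj₁ (inj₁ o)
Occurs-Conj-++⁻ (_ ∷ xs) (inj₂ o) with Occurs-Conj-++⁻ xs o
... | inj₁ p = inj₁ (inj₂ p)
... | inj₂ p = inj₂ p

Occurs-Conj-filter⁻ : ∀ n xs → Occurs x (Conj (filter (λ b → ¬? (b ≟A n)) xs)) → Occurs x (Conj xs)
Occurs-Conj-filter⁻ n (y ∷ xs) o with y ≟A n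
Occurs-Conj-filter⁻ n (y ∷ xs) o        | yes _ = inj₂ (Occurs-Conj-filter⁻ n xs o)
Occurs-Conj-filter⁻ n (y ∷ xs) (inj₁ o) | no  _ = inj₁ o
Occurs-Conj-filter⁻ n (y ∷ xs) (inj₂ o) | no  _ = inj₂ (Occurs-Conj-filter⁻ n xs o)

Occurs-Conj-replace⁻ : ∀ xs → n ∈ xs → (OccursA x a → OccursA x n) →
                       Occurs x (Conj (replace n a xs)) → Occurs x (Conj xs)
Occurs-Conj-replace⁻ {n = n} xs n∈ a⊆n o
  with Occurs-Conj-++⁻ (filter (λ b → ¬? (b ≟A n)) xs) o
... | inj₁ p        = Occurs-Conj-filter⁻ n xs p
... | inj₂ (inj₁ p) = Occurs-Conj-∈ n∈ (a⊆n p)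

record CaseSplit (n a b : Atom) : Set where
  field
    cover  : ∀ σ → holdsA σ n → holdsA σ a ⊎ holdsA σ b
    vars-a : ∀ x → OccursA x a → OccursA x n
    vars-b : ∀ x → OccursA x b → OccursA x n

≠-caseSplit : ∀ t → CaseSplit (nAtom t) (gAtom t) (lAtom t)
≠-caseSplit t = record { cover = cover ; vars-a = λ _ o → o ; vars-b = vars-b }
  where
  cover : ∀ σ → holdsA σ (nAtom t) → holdsA σ (gAtom t) ⊎ holdsA σ (lAtom t)
  cover σ 0≢t with <-cmp 0ℚ (evalT σ t)
  ... | tri< 0<t _    _   = inj₁ 0<t
  ... | tri≈ _   0≡t  _   = ⊥-elim (0≢t 0≡t)
  ... | tri> _   _    t<0 = inj₂ t<0

  vars-b : ∀ x → OccursA x (lAtom t) → OccursA x (nAtom t)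
  vars-b _ (inj₁ o) = inj₂ o

module _ {n a b : Atom} (split : CaseSplit n a b) {I⁺ I⁻ : Formula} where
  open CaseSplit split
  open Interpolant

  Interpolant-∨-splitˡ : ∀ {A Y} → n ∈ A →
    Interpolant (Conj (replace n a A)) Y I⁺ →
    Interpolant (Conj (replace n b A)) Y I⁻ →
    Interpolant (Conj A) Y (I⁺ ∨ᶠ I⁻)
  Interpolant-∨-splitˡ {A} {Y} n∈ P N = record
    { entails = entails′
    ; unsatY  = λ { σ (inj₁ i⁺ , y) → unsatY P σ (i⁺ , y)
                  ; σ (inj₂ i⁻ , y) → unsatY N σ (i⁻ , y) }
    ; shared  = shared′
    }
    where
    entails′ : Conj A ⊨ᶠ (I⁺ ∨ᶠ I⁻)
    entails′ σ hA with cover σ (Conj-∈ n∈ hA)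
    ... | inj₁ ha = inj₁ (entails P σ (Conj-replace⁺ n A hA ha))
    ... | inj₂ hb = inj₂ (entails N σ (Conj-replace⁺ n A hA hb))

    shared′ : ∀ x → Occurs x (I⁺ ∨ᶠ I⁻) → Occurs x (Conj A) × Occurs x Y
    shared′ x (inj₁ o) with shared P x o
    ... | oX , oY = Occurs-Conj-replace⁻ A n∈ (vars-a x) oX , oY
    shared′ x (inj₂ o) with shared N x o
    ... | oX , oY = Occurs-Conj-replace⁻ A n∈ (vars-b x) oX , oY

  Interpolant-∧-splitʳ : ∀ {X B} → n ∈ B →
    Interpolant X (Conj (replace n a B)) I⁺ →
    Interpolant X (Conj (replace n b B)) I⁻ →
    Interpolant X (Conj B) (I⁺ ∧ᶠ I⁻)
  Interpolant-∧-splitʳ {X} {B} n∈ P N = record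
    { entails = λ σ hX → entails P σ hX , entails N σ hX
    ; unsatY  = unsatY′
    ; shared  = shared′
    }
    where
    unsatY′ : Unsat ((I⁺ ∧ᶠ I⁻) ∧ᶠ Conj B)
    unsatY′ σ ((i⁺ , i⁻) , hB) with cover σ (Conj-∈ n∈ hB)
    ... | inj₁ ha = unsatY P σ (i⁺ , Conj-replace⁺ n B hB ha)
    ... | inj₂ hb = unsatY N σ (i⁻ , Conj-replace⁺ n B hB hb)

    shared′ : ∀ x → Occurs x (I⁺ ∧ᶠ I⁻) → Occurs x X × Occurs x (Conj B)
    shared′ x (inj₁ o) with shared P x o
    ... | oX , oY = oX , Occurs-Conj-replace⁻ B n∈ (vars-a x) oY
    shared′ x (inj₂ o) with shared N x o
    ... | oX , oY = oX , Occurs-Conj-replace⁻ B n∈ (vars-b x) oY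

mainTheorem4 : (A B : List Atom) (t : LinTerm) (I⁺ I⁻ : Formula) →
    (nAtom t ∈ A →
      Unsat (Conj (replace (nAtom t) (gAtom t) A) ∧ᶠ Conj B) →
      Unsat (Conj (replace (nAtom t) (lAtom t) A) ∧ᶠ Conj B) →
      Interpolant (Conj (replace (nAtom t) (gAtom t) A)) (Conj B) I⁺ →
      Interpolant (Conj (replace (nAtom t) (lAtom t) A)) (Conj B) I⁻ →
      Interpolant (Conj A) (Conj B) (I⁺ ∨ᶠ I⁻))
    ×
    (nAtom t ∈ B →
      Unsat (Conj A ∧ᶠ Conj (replace (nAtom t) (gAtom t) B)) →
      Unsat (Conj A ∧ᶠ Conj (replace (nAtom t) (lAtom t) B)) →
      Interpolant (Conj A) (Conj (replace (nAtom t) (gAtom t) B)) I⁺ →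
      Interpolant (Conj A) (Conj (replace (nAtom t) (lAtom t) B)) I⁻ →
      Interpolant (Conj A) (Conj B) (I⁺ ∧ᶠ I⁻))
mainTheorem4 A B t I⁺ I⁻ =
    (λ n∈A _ _ → Interpolant-∨-splitˡ (≠-caseSplit t) n∈A)
  , (λ n∈B _ _ → Interpolant-∧-splitʳ (≠-caseSplit t) n∈B)
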